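{- Let $m$ be a refinement mapping from a high-level BAT $\mathcal{D}^h$ to a low-level BAT $\mathcal{D}^l$. Then $\mathcal{D}^h$ is a complete abstraction of $\mathcal{D}^l$ relative to $m$ if and only if for every model $M_h$ of $\mathcal{D}^h$ there exists a model $M_l$ of $\mathcal{D}^l\cup\mathcal{C}$ such that: (a) $S_0^{M_h}\simeq_m^{M_h,M_l}S_0^{M_l}$; (b) $M_l\models\forall s.\,Do(\textsc{anyseqhl},S_0,s)\supset\bigwedge_{A_i\in\mathcal{A}^h}\forall\vec x.\,\big(m(\phi^{Poss}_{A_i}(\vec x))[s]\equiv\exists s'.\,Do(m(A_i(\vec x)),s,s')\big)$; (c) $M_l\models\forall s.\,Do(\textsc{anyseqhl},S_0,s)\supset\bigwedge_{A_i\in\mathcal{A}^h}\forall\vec x,s'.\,\Big(Do(m(A_i(\vec x)),s,s')\supset\bigwedge_{F_i\in\mathcal{F}^h}\forall\vec y\,\big(m(\phi^{ssa}_{F_i,A_i}(\vec y,\vec x))[s]\equiv m(F_i(\vec y))[s']\big)\Big)$, where $\phi^{Poss}_{A_i}(\vec x)$ is the (situation-suppressed) right-hand side of the precondition axiom of $A_i(\vec x)$ in $\mathcal{D}^h$, and $\phi^{ssa}_{F_i,A_i}(\vec y,\vec x)$ is the (situation-suppressed) right-hand side of the successor state axiom of $F_i$ in $\mathcal{D}^h$ instantiated with action $A_i(\vec x)$, with action terms eliminated using $\mathcal{D}^h_{ca}$.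
   Context: Situation calculus setting. Objects are a countably infinite set $\mathcal{N}$ of standard names (unique names and domain closure); no function symbols other than constants; no non-fluent predicates. Situations: $S_0$ and $do(a,s)$; $do([a_1,\dots,a_n],s)$ abbreviates $do(a_n,\dots,do(a_1,s)\dots)$. $Poss(a,s)$ means $a$ is executable in $s$. A basic action theory (BAT) over finitely many action types $\mathcal{A}$ and fluents $\mathcal{F}$ is the union of: initial-state axioms $\mathcal{D}_{S_0}$; precondition axioms $Poss(A(\vec x),s)\equiv\phi^{Poss}_A(\vec x,s)$; successor state axioms $F(\vec x,do(a,s))\equiv\phi^{ssa}_F(\vec x,a,s)$ (right-hand sides uniform in $s$); $\mathcal{D}_{ca}$, unique names axioms for actions and domain closure on action types; $\mathcal{D}_{coa}$, unique names and domain closure for the object constants in $\mathcal{N}$; and the foundational axioms $\Sigma$. A situation-suppressed formula omits situation arguments of fluents; $\phi[s]$ restores $s$. ConGolog programs $\delta::=\alpha\mid\varphi?\mid\delta_1;\delta_2\mid\delta_1|\delta_2\mid\pi x.\delta\mid\delta^*\mid\delta_1\|\delta_2$, $nil=True?$; $\mathcal{C}$ are the axioms: $Trans(\alpha,s,\delta',s')\equiv s'=do(\alpha,s)\land Poss(\alpha,s)\land\delta'=True?$; $Trans(\varphi?,s,\delta',s')\equiv False$; $Trans(\delta_1;\delta_2,s,\delta',s')\equiv\exists\delta_1'(Trans(\delta_1,s,\delta_1',s')\land\delta'=\delta_1';\delta_2)\lor(Final(\delta_1,s)\land Trans(\delta_2,s,\delta',s'))$; $Trans(\delta_1|\delta_2,\cdot)\equiv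 Trans(\delta_1,\cdot)\lor Trans(\delta_2,\cdot)$; $Trans(\pi x.\delta,s,\delta',s')\equiv\exists x.Trans(\delta,s,\delta',s')$; $Trans(\delta^*,s,\delta',s')\equiv\exists\delta''(Trans(\delta,s,\delta'',s')\land\delta'=\delta'';\delta^*)$; $Trans(\delta_1\|\delta_2,s,\delta',s')\equiv\exists\delta_1'(Trans(\delta_1,s,\delta_1',s')\land\delta'=\delta_1'\|\delta_2)\lor\exists\delta_2'(Trans(\delta_2,s,\delta_2',s')\land\delta'=\delta_1\|\delta_2')$; $Final(\alpha,s)\equiv False$; $Final(\varphi?,s)\equiv\varphi[s]$; $Final(\delta_1;\delta_2,s)\equiv Final(\delta_1,s)\land Final(\delta_2,s)$; $Final(\delta_1|\delta_2,s)\equiv Final(\delta_1,s)\lor Final(\delta_2,s)$; $Final(\pi x.\delta,s)\equiv\exists x.Final(\delta,s)$; $Final(\delta^*,s)\equiv True$; $Final(\delta_1\|\delta_2,s)\equiv Final(\delta_1,s)\land Final(\delta_2,s)$. $Do(\delta,s,s')\doteq\exists\delta'.Trans^*(\delta,s,\delta',s')\land Final(\delta',s')$, $Trans^*$ the reflexive transitive closure. $\mathcal{D}^h$ and $\mathcal{D}^l$ have action types $\mathcal{A}^h,\mathcal{A}^l$ and fluents $\mathcal{F}^h,\mathcal{F}^l$, sharing only $\mathcal{N}$. A refinement mapping $m$ maps each $A\in\mathcal{A}^h$ to a situation-determined ConGolog program $m(A(\vec x))$ over $\mathcal{D}^l$ with free variables $\vec x$, and each $F\in\mathcal{F}^h$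 to a situation-suppressed low-level formula $m(F(\vec x))$ with free variables $\vec x$; $m(\phi)$ substitutes $m(F(\vec x))$ for fluent atoms. $s_h\simeq_m^{M_h,M_l}s_l$ ($m$-isomorphic) iff for every $F\in\mathcal{F}^h$ and variable assignment $v$, $M_h,v[s/s_h]\models F(\vec x,s)$ iff $M_l,v[s/s_l]\models m(F(\vec x))[s]$. For a model $M_h$ of $\mathcal{D}^h$ and a model $M_l$ of $\mathcal{D}^l\cup\mathcal{C}$, a relation $B$ between situation domains is an $m$-bisimulation if each $\langle s_h,s_l\rangle\in B$ satisfies: (1) $s_h\simeq_m^{M_h,M_l}s_l$; (2) for each $A\in\mathcal{A}^h$ and $v$, if some $s_h'$ has $M_h,v[s/s_h,s'/s_h']\models Poss(A(\vec x),s)\land s'=do(A(\vec x),s)$ then some $s_l'$ has $M_l,v[s/s_l,s'/s_l']\models Do(m(A(\vec x)),s,s')$ and $\langle s_h',s_l'\rangle\in B$; (3) conversely, if some $s_l'$ has $M_l,v[s/s_l,s'/s_l']\models Do(m(A(\vec x)),s,s')$ then some $s_h'$ has $M_h,v[s/s_h,s'/s_h']\models Poss(A(\vec x),s)\land s'=do(A(\vec x),s)$ and $\langle s_h',s_l'\rangle\in B$. $M_h\sim_m M_l$ iff some $m$-bisimulation contains $\langle S_0^{M_h},S_0^{M_l}\rangle$. $\mathcal{D}^h$ is a complete abstraction of $\mathcal{D}^l$ relative to $m$ iff for every model $M_h$ of $\mathcal{D}^h$ there is a model $M_l$ of $\mathcal{D}^l\cup\mathcal{C}$ with $M_h\sim_m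 M_l$. $\textsc{any1hl}\doteq|_{A_i\in\mathcal{A}^h}\pi\vec x.\,m(A_i(\vec x))$ and $\textsc{anyseqhl}\doteq\textsc{any1hl}^*$. -}

module Defs where

open import Data.Nat using (ℕ; zero; suc)
open import Data.Fin using (Fin; zero; suc)
open import Data.Vec using (Vec; []; _∷_)
open import Data.Product using (Σ; _×_; _,_)
open import Data.Sum using (_⊎_)
open import Data.Empty using (⊥)
open import Data.Unit using (⊤)
open import Relation.Nullary using (¬_)
open import Relation.Binary.PropositionalEquality using (_≡_; _≢_)
open import Function.Bundles using (_⇔_)

-- Objects are the standard
-- names 𝒩, represented by ℕ (unique names + domain closure, 𝒟_coa).

record Sig : Set where
  field
    nAct  : ℕ
    actAr : Fin nAct → ℕ
    nFlu  : ℕ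
    fluAr : Fin nFlu → ℕ
open Sig public

-- Ground actions A(n⃗): unique names + domain closure for actions (𝒟_ca)
-- are built in, since the action domain is exactly this syntactic type.
Action : Sig → Set
Action σ = Σ (Fin (nAct σ)) λ A → Vec ℕ (actAr σ A)

-- Situation-suppressed formulas (higher-order abstract syntax for the
-- object quantifiers; free variables are represented by Agda functions).

data Fml (σ : Sig) : Set where
  atom  : (F : Fin (nFlu σ)) → Vec ℕ (fluAr σ F) → Fml σ
  _==_  : ℕ → ℕ → Fml σ
  true  : Fml σ
  false : Fml σ
  ¬'_   : Fml σ → Fml σ
  _∧'_  : Fml σ → Fml σ → Fml σ
  _∨'_  : Fml σ → Fml σ → Fml σ
  _⊃'_  : Fml σ → Fml σ → Fml σ
  _≡'_  : Fml σ → Fml σ → Fml σ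
  all   : (ℕ → Fml σ) → Fml σ
  ex    : (ℕ → Fml σ) → Fml σ

-- Basic action theory over a signature.
--   init : the sentences of 𝒟_S0 (an arbitrary, possibly infinite, family)
--   poss A x⃗ : φ^Poss_A(x⃗)  (rhs of the precondition axiom)
--   ssa F A y⃗ x⃗ : φ^ssa_F(y⃗, A(x⃗))  (rhs of the SSA of F instantiated
--        with the action A(x⃗), action terms eliminated using 𝒟_ca)

record BAT (σ : Sig) : Set₁ where
  field
    InitIx : Set
    init   : InitIx → Fml σ
    poss   : (A : Fin (nAct σ)) → Vec ℕ (actAr σ A) → Fml σ
    ssa    : (F : Fin (nFlu σ)) (A : Fin (nAct σ)) →
             Vec ℕ (fluAr σ F) → Vec ℕ (actAr σ A) → Fml σ
open BAT public

record Structure (σ : Sig) : Set₁ where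
  field
    Sit   : Set
    S0    : Sit
    doA   : Action σ → Sit → Sit
    Holds : (F : Fin (nFlu σ)) → Vec ℕ (fluAr σ F) → Sit → Set
    Poss  : Action σ → Sit → Set
open Structure public

sat : ∀ {σ} (M : Structure σ) → Fml σ → Sit M → Set
sat M (atom F xs) s = Holds M F xs s
sat M (x == y)    s = x ≡ y
sat M true        s = ⊤
sat M false       s = ⊥
sat M (¬' φ)      s = ¬ sat M φ s
sat M (φ ∧' ψ)    s = sat M φ s × sat M ψ s
sat M (φ ∨' ψ)    s = sat M φ s ⊎ sat M ψ s
sat M (φ ⊃' ψ)    s = sat M φ s → sat M ψ s
sat M (φ ≡' ψ)    s = sat M φ s ⇔ sat M ψ s
sat M (all f)     s = (n : ℕ) → sat M (f n) s
sat M (ex f)      s = Σ ℕ λ n → sat M (f n) s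

-- M is a model of the BAT 𝒟 (foundational axioms Σ, 𝒟_S0, 𝒟_ap, 𝒟_ss;
-- 𝒟_ca and 𝒟_coa are built into the representation).
record IsModel {σ} (D : BAT σ) (M : Structure σ) : Set₁ where
  field
    do-inj    : ∀ a a' s s' → doA M a s ≡ doA M a' s' → (a ≡ a') × (s ≡ s')
    S0≢do     : ∀ a s → S0 M ≢ doA M a s
    induction : (P : Sit M → Set) → P (S0 M) →
                (∀ a s → P s → P (doA M a s)) → ∀ s → P s
    initAx    : ∀ i → sat M (init D i) (S0 M)
    possAx    : ∀ A xs s → Poss M (A , xs) s ⇔ sat M (poss D A xs) s
    ssaAx     : ∀ F A ys xs s →
                Holds M F ys (doA M (A , xs) s) ⇔ sat M (ssa D F A ys xs) s

data Prog (σ : Sig) : Set where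
  act   : Action σ → Prog σ
  _¿    : Fml σ → Prog σ
  _⨾_   : Prog σ → Prog σ → Prog σ
  _∣_   : Prog σ → Prog σ → Prog σ
  π     : (ℕ → Prog σ) → Prog σ
  _*    : Prog σ → Prog σ
  _∥_   : Prog σ → Prog σ → Prog σ

nil : ∀ {σ} → Prog σ
nil = true ¿

-- The axioms 𝒞 for Final and Trans, read as the (unique) predicates they
-- define on the standard program domain of a structure.
Final : ∀ {σ} (M : Structure σ) → Prog σ → Sit M → Set
Final M (act a)   s = ⊥
Final M (φ ¿)     s = sat M φ s
Final M (δ₁ ⨾ δ₂) s = Final M δ₁ s × Final M δ₂ s
Final M (δ₁ ∣ δ₂) s = Final M δ₁ s ⊎ Final M δ₂ s
Final M (π f)     s = Σ ℕ λ x → Final M (f x) s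
Final M (δ *)     s = ⊤
Final M (δ₁ ∥ δ₂) s = Final M δ₁ s × Final M δ₂ s

Trans : ∀ {σ} (M : Structure σ) → Prog σ → Sit M → Prog σ → Sit M → Set
Trans M (act a)   s δ' s' = (s' ≡ doA M a s) × Poss M a s × (δ' ≡ nil)
Trans M (φ ¿)     s δ' s' = ⊥
Trans M (δ₁ ⨾ δ₂) s δ' s' =
  (Σ (Prog _) λ δ₁' → Trans M δ₁ s δ₁' s' × (δ' ≡ (δ₁' ⨾ δ₂)))
  ⊎ (Final M δ₁ s × Trans M δ₂ s δ' s')
Trans M (δ₁ ∣ δ₂) s δ' s' = Trans M δ₁ s δ' s' ⊎ Trans M δ₂ s δ' s'
Trans M (π f)     s δ' s' = Σ ℕ λ x → Trans M (f x) s δ' s'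
Trans M (δ *)     s δ' s' =
  Σ (Prog _) λ δ'' → Trans M δ s δ'' s' × (δ' ≡ (δ'' ⨾ (δ *)))
Trans M (δ₁ ∥ δ₂) s δ' s' =
  (Σ (Prog _) λ δ₁' → Trans M δ₁ s δ₁' s' × (δ' ≡ (δ₁' ∥ δ₂)))
  ⊎ (Σ (Prog _) λ δ₂' → Trans M δ₂ s δ₂' s' × (δ' ≡ (δ₁ ∥ δ₂')))

data Trans* {σ} (M : Structure σ) : Prog σ → Sit M → Prog σ → Sit M → Set where
  refl* : ∀ δ s → Trans* M δ s δ s
  step* : ∀ {δ s δ' s' δ'' s''} → Trans M δ s δ' s' →
          Trans* M δ' s' δ'' s'' → Trans* M δ s δ'' s''

Do : ∀ {σ} (M : Structure σ) → Prog σ → Sit M → Sit M → Set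
Do M δ s s' = Σ (Prog _) λ δ' → Trans* M δ s δ' s' × Final M δ' s'

SitDet : ∀ {σ} (M : Structure σ) → Prog σ → Sit M → Set
SitDet M δ s = ∀ s' δ' δ'' → Trans* M δ s δ' s' → Trans* M δ s δ'' s' → δ' ≡ δ''

record RefMap {σh σl : Sig} (Dh : BAT σh) (Dl : BAT σl) : Set₁ where
  field
    mAct : (A : Fin (nAct σh)) → Vec ℕ (actAr σh A) → Prog σl
    mFlu : (F : Fin (nFlu σh)) → Vec ℕ (fluAr σh F) → Fml σl
    sitDet : ∀ (Ml : Structure σl) → IsModel Dl Ml →
             ∀ A xs s → SitDet Ml (mAct A xs) s
open RefMap public

mapFml : ∀ {σh σl} → ((F : Fin (nFlu σh)) → Vec ℕ (fluAr σh F) → Fml σl) →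
         Fml σh → Fml σl
mapFml m (atom F xs) = m F xs
mapFml m (x == y)    = x == y
mapFml m true        = true
mapFml m false       = false
mapFml m (¬' φ)      = ¬' mapFml m φ
mapFml m (φ ∧' ψ)    = mapFml m φ ∧' mapFml m ψ
mapFml m (φ ∨' ψ)    = mapFml m φ ∨' mapFml m ψ
mapFml m (φ ⊃' ψ)    = mapFml m φ ⊃' mapFml m ψ
mapFml m (φ ≡' ψ)    = mapFml m φ ≡' mapFml m ψ
mapFml m (all f)     = all λ n → mapFml m (f n)
mapFml m (ex f)      = ex λ n → mapFml m (f n)

module _ {σh σl : Sig} {Dh : BAT σh} {Dl : BAT σl} (m : RefMap Dh Dl)
         (Mh : Structure σh) (Ml : Structure σl) where

  MIso : Sit Mh → Sit Ml → Set
  MIso sh sl = ∀ F ys → Holds Mh F ys sh ⇔ sat Ml (mFlu m F ys) sl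

  IsMBisim : (Sit Mh → Sit Ml → Set) → Set
  IsMBisim B = ∀ sh sl → B sh sl →
      MIso sh sl
    × (∀ A xs sh' → Poss Mh (A , xs) sh → sh' ≡ doA Mh (A , xs) sh →
         Σ (Sit Ml) λ sl' → Do Ml (mAct m A xs) sl sl' × B sh' sl')
    × (∀ A xs sl' → Do Ml (mAct m A xs) sl sl' →
         Σ (Sit Mh) λ sh' → Poss Mh (A , xs) sh × (sh' ≡ doA Mh (A , xs) sh)
                             × B sh' sl')

  MBisimilar : Set₁
  MBisimilar = Σ (Sit Mh → Sit Ml → Set) λ B → IsMBisim B × B (S0 Mh) (S0 Ml)

CompleteAbstraction : ∀ {σh σl} (Dh : BAT σh) (Dl : BAT σl) → RefMap Dh Dl → Set₁
CompleteAbstraction {σh} {σl} Dh Dl m =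
  (Mh : Structure σh) → IsModel Dh Mh →
  Σ (Structure σl) λ Ml → IsModel Dl Ml × MBisimilar m Mh Ml

πVec : ∀ {σ} k → (Vec ℕ k → Prog σ) → Prog σ
πVec zero    f = f []
πVec (suc k) f = π λ x → πVec k λ xs → f (x ∷ xs)

-- nondeterministic choice over finitely many alternatives
-- (the empty choice is False?, which has no transitions and is not final)
choiceFin : ∀ {σ} n → (Fin n → Prog σ) → Prog σ
choiceFin zero          f = false ¿
choiceFin (suc zero)    f = f zero
choiceFin (suc (suc n)) f = f zero ∣ choiceFin (suc n) (λ i → f (suc i))

any1hl : ∀ {σh σl} {Dh : BAT σh} {Dl : BAT σl} → RefMap Dh Dl → Prog σl
any1hl {σh} m = choiceFin (nAct σh) λ A → πVec (actAr σh A) (mAct m A)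

anyseqhl : ∀ {σh σl} {Dh : BAT σh} {Dl : BAT σl} → RefMap Dh Dl → Prog σl
anyseqhl m = any1hl m *

module _ {σh σl : Sig} {Dh : BAT σh} {Dl : BAT σl} (m : RefMap Dh Dl)
         (Mh : Structure σh) (Ml : Structure σl) where

  CondA : Set
  CondA = MIso m Mh Ml (S0 Mh) (S0 Ml)

  CondB : Set
  CondB = ∀ s → Do Ml (anyseqhl m) (S0 Ml) s →
          ∀ A xs → sat Ml (mapFml (mFlu m) (poss Dh A xs)) s
                   ⇔ (Σ (Sit Ml) λ s' → Do Ml (mAct m A xs) s s')

  CondC : Set
  CondC = ∀ s → Do Ml (anyseqhl m) (S0 Ml) s →
          ∀ A xs s' → Do Ml (mAct m A xs) s s' →
          ∀ F ys → sat Ml (mapFml (mFlu m) (ssa Dh F A ys xs)) s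
                   ⇔ sat Ml (mFlu m F ys) s'

-- The program anyseqhl is the Kleene star of a choice among the refinements
-- m(A(x⃗)), so a low-level situation is reached by anyseqhl from S0 exactly
-- when it is reachable from S0 by a sequence of refined high-level actions.
-- Along an m-isomorphism every high-level formula φ holds iff m(φ) does;
-- applied to the precondition and successor state axioms of 𝒟^h, this makes
-- conditions (b) and (c) say precisely that relating s_h to every reachable
-- s_l m-isomorphic to it is an m-bisimulation, and (a) puts the initial
-- situations in it.  Conversely, in an m-bisimulation containing the initial
-- pair every reachable s_l is related to some s_h, which gives (b) and (c),
-- and (a) is the isomorphism clause at S0.
module Submission where

open import Defs
open import Data.Nat using (ℕ; zero; suc)
open import Data.Fin using (Fin; zero; suc)
open import Data.Vec using (Vec; []; _∷_)
open import Data.Product using (Σ; ∃; ∃₂; _×_; _,_; proj₁; proj₂; map₂)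
open import Data.Product.Function.NonDependent.Propositional using (_×-⇔_)
open import Data.Sum using (_⊎_; inj₁; inj₂)
open import Data.Sum.Function.Propositional using (_⊎-⇔_)
open import Data.Unit using (tt)
open import Function using (_∘_)
open import Function.Bundles using (_⇔_; mk⇔; Equivalence)
open import Function.Construct.Identity using (⇔-id)
open import Function.Construct.Symmetry using (⇔-sym)
open import Function.Construct.Composition using (_⇔-∘_)
open import Function.Related.Propositional using (equivalence)
open import Function.Related.TypeIsomorphisms using (→-cong-⇔; ¬-cong-⇔; Related-cong)
open import Relation.Nullary using (¬_; contradiction)
open import Relation.Binary.PropositionalEquality using (refl)
open import Relation.Binary.Construct.Closure.ReflexiveTransitive as Star
  using (Star; ε; _◅_; _◅◅_)
open Equivalence

-- P will be Final M · s or Trans M · s δ' s', both of which read ∣ as ⊎, π as ∃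
-- and False? as ⊥ by definition.
module _ {σ : Sig} (P : Prog σ → Set) where

  choiceFin-⇔ : (∀ {δ₁ δ₂} → P (δ₁ ∣ δ₂) ⇔ (P δ₁ ⊎ P δ₂)) → ¬ P (false ¿) →
                ∀ n (f : Fin n → Prog σ) → P (choiceFin n f) ⇔ ∃ λ i → P (f i)
  choiceFin-⇔ P-∣ P-false zero f = mk⇔ (λ p → contradiction p P-false) λ ()
  choiceFin-⇔ P-∣ P-false (suc zero) f = mk⇔ (zero ,_) λ where (zero , p) → p
  choiceFin-⇔ P-∣ P-false (suc (suc n)) f =
    mk⇔ (λ where (inj₁ p) → zero , p
                 (inj₂ (i , p)) → suc i , p)
        (λ where (zero , p) → inj₁ p
                 (suc i , p) → inj₂ (i , p))
    ⇔-∘ ((⇔-id _ ⊎-⇔ choiceFin-⇔ P-∣ P-false (suc n) (f ∘ suc)) ⇔-∘ P-∣)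

  πVec-⇔ : (∀ {g} → P (π g) ⇔ ∃ λ x → P (g x)) →
           ∀ k (f : Vec ℕ k → Prog σ) → P (πVec k f) ⇔ ∃ λ xs → P (f xs)
  πVec-⇔ P-π zero f = mk⇔ ([] ,_) λ where ([] , p) → p
  πVec-⇔ P-π (suc k) f = mk⇔
    (λ p → let (x , q) = to P-π p
               (xs , r) = to (πVec-⇔ P-π k (f ∘ (x ∷_))) q
           in x ∷ xs , r)
    (λ where (x ∷ xs , p) → from P-π (x , from (πVec-⇔ P-π k (f ∘ (x ∷_))) (xs , p)))

module _ {σ : Sig} (M : Structure σ) where

  IsChoiceOf : {I : Set} → Prog σ → (I → Prog σ) → Set
  IsChoiceOf δ g = (∀ {s} → Final M δ s ⇔ ∃ λ i → Final M (g i) s)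
                 × (∀ {s δ' s'} → Trans M δ s δ' s' ⇔ ∃ λ i → Trans M (g i) s δ' s')

  choiceFin-isChoiceOf : ∀ n (f : Fin n → Prog σ) → IsChoiceOf (choiceFin n f) f
  choiceFin-isChoiceOf n f =
      (λ {s} → choiceFin-⇔ (λ δ → Final M δ s) (⇔-id _) (λ ()) n f)
    , (λ {s δ' s'} → choiceFin-⇔ (λ δ → Trans M δ s δ' s') (⇔-id _) (λ ()) n f)

  πVec-isChoiceOf : ∀ k (f : Vec ℕ k → Prog σ) → IsChoiceOf (πVec k f) f
  πVec-isChoiceOf k f =
      (λ {s} → πVec-⇔ (λ δ → Final M δ s) (⇔-id _) k f)
    , (λ {s δ' s'} → πVec-⇔ (λ δ → Trans M δ s δ' s') (⇔-id _) k f)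

  module _ {I : Set} {δ : Prog σ} {g : I → Prog σ} (choice : IsChoiceOf δ g) where

    Do-choice⁺ : ∀ {s s'} → Do M δ s s' → ∃ λ i → Do M (g i) s s'
    Do-choice⁺ (_ , refl* _ _ , f) = let (i , f') = to (proj₁ choice) f in i , _ , refl* _ _ , f'
    Do-choice⁺ (δ' , step* t r , f) = let (i , t') = to (proj₂ choice) t in i , δ' , step* t' r , f

    Do-choice⁻ : ∀ {s s'} → ∃ (λ i → Do M (g i) s s') → Do M δ s s'
    Do-choice⁻ (i , _ , refl* _ _ , f) = _ , refl* _ _ , from (proj₁ choice) (i , f)
    Do-choice⁻ (i , δ' , step* t r , f) = δ' , step* (from (proj₂ choice) (i , t)) r , f

    Do-choice : ∀ {s s'} → Do M δ s s' ⇔ ∃ λ i → Do M (g i) s s'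
    Do-choice = mk⇔ Do-choice⁺ Do-choice⁻

  Do-step : ∀ {δ s δ' s' s''} → Trans M δ s δ' s' → Do M δ' s' s'' → Do M δ s s''
  Do-step t (δ'' , r , f) = δ'' , step* t r , f

  Do-prepend : ∀ {δ s δ' s' s''} → Trans* M δ s δ' s' → Do M δ' s' s'' → Do M δ s s''
  Do-prepend (refl* _ _) d = d
  Do-prepend (step* t r) d = Do-step t (Do-prepend r d)

  Trans*-⨾ : ∀ {γ s γ' s'} ρ → Trans* M γ s γ' s' → Trans* M (γ ⨾ ρ) s (γ' ⨾ ρ) s'
  Trans*-⨾ ρ (refl* _ _) = refl* _ _
  Trans*-⨾ ρ (step* t r) = step* (inj₁ (_ , t , refl)) (Trans*-⨾ ρ r)

  Do-⨾-final : ∀ {γ ρ s s'} → Final M γ s → Do M ρ s s' → Do M (γ ⨾ ρ) s s'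
  Do-⨾-final fγ (_ , refl* _ _ , f) = _ , refl* _ _ , fγ , f
  Do-⨾-final fγ (δ , step* t r , f) = δ , step* (inj₂ (fγ , t)) r , f

  Do-⨾ : ∀ {γ ρ s s₁ s₂} → Do M γ s s₁ → Do M ρ s₁ s₂ → Do M (γ ⨾ ρ) s s₂
  Do-⨾ {ρ = ρ} (_ , r , fγ) d = Do-prepend (Trans*-⨾ ρ r) (Do-⨾-final fγ d)

  Do-*-cons : ∀ {δ s s₁ s₂} → Do M δ s s₁ → Do M (δ *) s₁ s₂ → Do M (δ *) s s₂
  Do-*-cons (_ , refl* _ _ , _) d = d
  Do-*-cons (δ' , step* t r , f) d = Do-step (_ , t , refl) (Do-⨾ (δ' , r , f) d)

  Do-⨾*-split : ∀ {γ δ s δ' s'} → Trans* M (γ ⨾ (δ *)) s δ' s' → Final M δ' s' →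
                ∃ λ s₁ → Do M γ s s₁ × Star (Do M δ) s₁ s'
  Do-⨾*-split (refl* _ _) (fγ , tt) = _ , (_ , refl* _ _ , fγ) , ε
  Do-⨾*-split (step* (inj₁ (_ , t , refl)) r) f =
    let (s₁ , d , ds) = Do-⨾*-split r f in s₁ , Do-step t d , ds
  Do-⨾*-split (step* (inj₂ (fγ , _ , t , refl)) r) f =
    let (_ , d , ds) = Do-⨾*-split r f in _ , (_ , refl* _ _ , fγ) , Do-step t d ◅ ds

  Do-*⇒Star : ∀ {δ s s'} → Do M (δ *) s s' → Star (Do M δ) s s'
  Do-*⇒Star (_ , refl* _ _ , _) = ε
  Do-*⇒Star (_ , step* (_ , t , refl) r , f) =
    let (_ , d , ds) = Do-⨾*-split r f in Do-step t d ◅ ds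

  Do-*⇔Star : ∀ {δ s s'} → Do M (δ *) s s' ⇔ Star (Do M δ) s s'
  Do-*⇔Star {δ} = mk⇔ Do-*⇒Star (Star.fold (Do M (δ *)) Do-*-cons (_ , refl* _ _ , tt))

module _ {σh σl : Sig} {Dh : BAT σh} {Dl : BAT σl} (m : RefMap Dh Dl) where

  RefinedStep : (Ml : Structure σl) → Sit Ml → Sit Ml → Set
  RefinedStep Ml s s' = ∃₂ λ A xs → Do Ml (mAct m A xs) s s'

  module _ {Ml : Structure σl} where

    Do-any1hl : ∀ {s s'} → Do Ml (any1hl m) s s' ⇔ RefinedStep Ml s s'
    Do-any1hl {s} {s'} =
      mk⇔ (map₂ (to Do-πVec) ∘ to Do-choiceFin) (from Do-choiceFin ∘ map₂ (from Do-πVec))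
      where
        Do-choiceFin : Do Ml (any1hl m) s s' ⇔ ∃ λ A → Do Ml (πVec (actAr σh A) (mAct m A)) s s'
        Do-choiceFin = Do-choice Ml (choiceFin-isChoiceOf Ml _ _)

        Do-πVec : ∀ {A} → Do Ml (πVec (actAr σh A) (mAct m A)) s s'
                        ⇔ ∃ λ xs → Do Ml (mAct m A xs) s s'
        Do-πVec = Do-choice Ml (πVec-isChoiceOf Ml _ _)

    Do-anyseqhl : ∀ {s s'} → Do Ml (anyseqhl m) s s' ⇔ Star (RefinedStep Ml) s s'
    Do-anyseqhl = mk⇔ (Star.map (to Do-any1hl) ∘ to (Do-*⇔Star Ml))
                      (from (Do-*⇔Star Ml) ∘ Star.map (from Do-any1hl))

  module _ {Mh : Structure σh} {Ml : Structure σl} where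

    sat-mapFml : ∀ {sh sl} → MIso m Mh Ml sh sl →
                 ∀ φ → sat Mh φ sh ⇔ sat Ml (mapFml (mFlu m) φ) sl
    sat-mapFml iso (atom F xs) = iso F xs
    sat-mapFml iso (x == y)    = ⇔-id _
    sat-mapFml iso true        = ⇔-id _
    sat-mapFml iso false       = ⇔-id _
    sat-mapFml iso (¬' φ)      = ¬-cong-⇔ (sat-mapFml iso φ)
    sat-mapFml iso (φ ∧' ψ)    = sat-mapFml iso φ ×-⇔ sat-mapFml iso ψ
    sat-mapFml iso (φ ∨' ψ)    = sat-mapFml iso φ ⊎-⇔ sat-mapFml iso ψ
    sat-mapFml iso (φ ⊃' ψ)    = →-cong-⇔ (sat-mapFml iso φ) (sat-mapFml iso ψ)
    sat-mapFml iso (φ ≡' ψ)    = Related-cong {k = equivalence} (sat-mapFml iso φ) (sat-mapFml iso ψ)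
    sat-mapFml iso (all f)     = mk⇔ (λ p n → to (sat-mapFml iso (f n)) (p n))
                                     (λ p n → from (sat-mapFml iso (f n)) (p n))
    sat-mapFml iso (ex f)      = mk⇔ (map₂ (to (sat-mapFml iso (f _))))
                                     (map₂ (from (sat-mapFml iso (f _))))

    module _ (isMh : IsModel Dh Mh) {sh : Sit Mh} {sl : Sit Ml} (iso : MIso m Mh Ml sh sl) where
      open IsModel isMh

      Poss-mapFml : ∀ A xs → Poss Mh (A , xs) sh ⇔ sat Ml (mapFml (mFlu m) (poss Dh A xs)) sl
      Poss-mapFml A xs = sat-mapFml iso (poss Dh A xs) ⇔-∘ possAx A xs sh

      Holds-do-mapFml : ∀ F A ys xs →
                        Holds Mh F ys (doA Mh (A , xs) sh)
                        ⇔ sat Ml (mapFml (mFlu m) (ssa Dh F A ys xs)) sl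
      Holds-do-mapFml F A ys xs = sat-mapFml iso (ssa Dh F A ys xs) ⇔-∘ ssaAx F A ys xs sh

    module _ {B : Sit Mh → Sit Ml → Set} (bisim : IsMBisim m Mh Ml B) where

      IsMBisim-reachable : ∀ {sh sl s} → B sh sl → Star (RefinedStep Ml) sl s → ∃ λ sh' → B sh' s
      IsMBisim-reachable b ε = _ , b
      IsMBisim-reachable b ((A , xs , d) ◅ ds) =
        let (_ , _ , _ , b') = proj₂ (proj₂ (bisim _ _ b)) A xs _ d in IsMBisim-reachable b' ds

      IsMBisim-step-MIso : ∀ {sh sl sl' A xs} → B sh sl → Do Ml (mAct m A xs) sl sl' →
                           MIso m Mh Ml (doA Mh (A , xs) sh) sl'
      IsMBisim-step-MIso b d with proj₂ (proj₂ (bisim _ _ b)) _ _ _ d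
      ... | _ , _ , refl , b' = proj₁ (bisim _ _ b')

      module _ (isMh : IsModel Dh Mh) (b₀ : B (S0 Mh) (S0 Ml)) where

        IsMBisim⇒CondB : CondB m Mh Ml
        IsMBisim⇒CondB s run A xs =
          let (sh , b) = IsMBisim-reachable b₀ (to Do-anyseqhl run)
              (iso , forth , back) = bisim sh s b
          in mk⇔ (λ q → let (sl' , d , _) = forth A xs _ (from (Poss-mapFml isMh iso A xs) q) refl
                        in sl' , d)
                 (λ (sl' , d) → let (_ , p , _) = back A xs sl' d
                                in to (Poss-mapFml isMh iso A xs) p)

        IsMBisim⇒CondC : CondC m Mh Ml
        IsMBisim⇒CondC s run A xs s' d F ys =
          let (sh , b) = IsMBisim-reachable b₀ (to Do-anyseqhl run)
              iso = proj₁ (bisim sh s b)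
          in IsMBisim-step-MIso b d F ys ⇔-∘ ⇔-sym (Holds-do-mapFml isMh iso F A ys xs)

    ReachableMIso : Sit Mh → Sit Ml → Set
    ReachableMIso sh sl = Star (RefinedStep Ml) (S0 Ml) sl × MIso m Mh Ml sh sl

    module _ (isMh : IsModel Dh Mh) (condB : CondB m Mh Ml) (condC : CondC m Mh Ml) where

      ReachableMIso-step : ∀ {sh sl sl' A xs} → ReachableMIso sh sl → Do Ml (mAct m A xs) sl sl' →
                           ReachableMIso (doA Mh (A , xs) sh) sl'
      ReachableMIso-step (reach , iso) d =
          reach ◅◅ (_ , _ , d) ◅ ε
        , λ F ys → condC _ (from Do-anyseqhl reach) _ _ _ d F ys ⇔-∘ Holds-do-mapFml isMh iso F _ ys _

      ReachableMIso-Poss : ∀ {sh sl} → ReachableMIso sh sl →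
                           ∀ A xs → Poss Mh (A , xs) sh ⇔ ∃ λ sl' → Do Ml (mAct m A xs) sl sl'
      ReachableMIso-Poss (reach , iso) A xs =
        condB _ (from Do-anyseqhl reach) A xs ⇔-∘ Poss-mapFml isMh iso A xs

      ReachableMIso-isMBisim : IsMBisim m Mh Ml ReachableMIso
      ReachableMIso-isMBisim sh sl r@(_ , iso) =
          iso
        , (λ where A xs _ p refl → let (sl' , d) = to (ReachableMIso-Poss r A xs) p
                                   in sl' , d , ReachableMIso-step r d)
        , λ A xs sl' d →
              doA Mh (A , xs) sh
            , from (ReachableMIso-Poss r A xs) (sl' , d)
            , refl
            , ReachableMIso-step r d

theorem7 : {σh σl : Sig} (Dh : BAT σh) (Dl : BAT σl) (m : RefMap Dh Dl) →
    CompleteAbstraction Dh Dl m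
    ⇔ ((Mh : Structure σh) → IsModel Dh Mh →
        Σ (Structure σl) λ Ml → IsModel Dl Ml
          × CondA m Mh Ml × CondB m Mh Ml × CondC m Mh Ml)
theorem7 Dh Dl m = mk⇔
  (λ (complete : CompleteAbstraction Dh Dl m) Mh isMh →
     let (Ml , isMl , B , bisim , b₀) = complete Mh isMh
     in Ml , isMl , proj₁ (bisim _ _ b₀)
           , IsMBisim⇒CondB m bisim isMh b₀ , IsMBisim⇒CondC m bisim isMh b₀)
  (λ conditions Mh isMh →
     let (Ml , isMl , condA , condB , condC) = conditions Mh isMh
     in Ml , isMl , ReachableMIso m {Mh} {Ml} , ReachableMIso-isMBisim m isMh condB condC , ε , condA)
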